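{- Let $\mathcal{D}$ be the arena of a playable $p$-periodic temporal graph on vertex set $V$ and let $k\ge 1$. The set of augmented $k$-arenas of $\mathcal{D}$, partially ordered by inclusion of hyperedge sets, is a complete lattice; in particular it has a maximum element $\mathcal{A}^k_{\max}$.
   Context: Let $V$ be a finite set of $n$ vertices and $p\ge 1$ an integer. A $p$-periodic temporal graph $\mathcal{G}=(G_0,\dots,G_{p-1})^*$ is the infinite sequence of directed graphs whose snapshot at time $t\in\{0,1,2,\dots\}$ is $G_{t\bmod p}=(V,E_{t\bmod p})$, where each $E_i\subseteq V\times V$ may contain self-loops, and every vertex of every $G_i$ has at least one outgoing edge (playable). Slice indices are taken modulo $p$. The arena of $\mathcal{G}$ is the directed graph $\mathcal{D}$ on $\mathbb{Z}_p\times V$ with $((i,u),(i+1,v))\in E(\mathcal{D})$ iff $(u,v)\in E_i$; write $\Gamma_t(u,\mathcal{D})=\{v:((t,u),(t+1,v))\in E(\mathcal{D})\}$. $[V]^k$ denotes the set of multisets of $k$ elements of $V$. Game with $k$ cops and one robber (restless, full information): cops occupy a multiset $C\in[V]^k$ of vertices, the robber a vertex $r$. In each round $t$, first every cop simultaneously moves from its vertex $c$ to some vertex of $\Gamma_{t\bmod p}(c,\mathcal{D})$, then the robber moves from $r$ to some $r'\in\Gamma_{t\bmod p}(r,\mathcal{D})$. The cops win if some cop moves onto the robber's current vertex (a position where the robber shares a vertex with a cop counts as capture); the robber wins by avoiding capture forever. A configuration $(t,C,r)$ (cops at $C$, robber at $r$ at the start of round $t$, cops to move) is $k$-copwin if the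 cops have a strategy guaranteeing capture from it; this depends only on $t\bmod p$. A hyperedge is a pair $((t,X),(t+1,y))$ with $t\in\mathbb{Z}_p$, $X\in[V]^k$ (the multiset $\{t\}\times X$ of temporal nodes) and $y\in V$. The $k$-arena $\mathcal{D}^k$ has as hyperedges all $((t,X),(t+1,y))$ such that some $x\in X$ has $((t,x),(t+1,y))\in E(\mathcal{D})$. An augmented $k$-arena of $\mathcal{D}$ is a set $\mathcal{A}^k$ of hyperedges containing all hyperedges of $\mathcal{D}^k$ such that for every hyperedge $((t,X),(t+1,y))\in\mathcal{A}^k$ the configuration $(t,X,y)$ is $k$-copwin. -}

module Defs where

open import Level using (0ℓ)
open import Data.Nat using (ℕ; suc; NonZero)
open import Data.Nat.DivMod using (_mod_)
open import Data.Fin using (Fin; toℕ)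
open import Data.Fin.Properties using (≤-totalOrder)
open import Data.List using (List; length)
open import Data.List.Membership.Propositional using (_∈_)
open import Data.List.Relation.Unary.Sorted.TotalOrder using (Sorted)
open import Data.List.Relation.Binary.Pointwise using (Pointwise)
open import Data.List.Relation.Binary.Permutation.Propositional using (_↭_)
open import Data.Product using (Σ; ∃; _×_; _,_; proj₁)
open import Data.Sum using (_⊎_)
open import Relation.Binary.PropositionalEquality using (_≡_)

-- [V]^k with V = Fin n: multisets of k vertices, represented canonically
-- as sorted lists of length k.
record Multiset (n k : ℕ) : Set where
  constructor mset
  field
    elems  : List (Fin n)
    size   : length elems ≡ k
    sorted : Sorted (≤-totalOrder n) elems
open Multiset public

-- A p-periodic temporal graph on V = Fin n: edge relations E_0 … E_{p-1}
-- (self-loops allowed); G i u v means (u,v) ∈ E_i.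
TemporalGraph : ℕ → ℕ → Set₁
TemporalGraph n p = Fin p → Fin n → Fin n → Set

Playable : ∀ {n p} → TemporalGraph n p → Set
Playable G = ∀ i u → ∃ λ v → G i u v

next : ∀ {p} → .{{NonZero p}} → Fin p → Fin p
next {p} i = suc (toℕ i) mod p

ArenaEdge : ∀ {n p} → .{{NonZero p}} → TemporalGraph n p →
            (Fin p × Fin n) → (Fin p × Fin n) → Set
ArenaEdge G (i , u) (j , v) = (j ≡ next i) × G i u v

Γ : ∀ {n p} → .{{NonZero p}} → TemporalGraph n p → Fin p → Fin n → Fin n → Set
Γ G t u v = ArenaEdge G (t , u) (next t , v)

-- The cops move simultaneously from C to C' in round t: each cop at c moves to
-- some vertex of Γ_t(c); C' is the resulting multiset.
CopMove : ∀ {n p k} → .{{NonZero p}} → TemporalGraph n p → Fin p →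
          Multiset n k → Multiset n k → Set
CopMove G t C C' = ∃ λ (w : List _) → Pointwise (Γ G t) (elems C) w × (w ↭ elems C')

-- k-copwin configurations (t, C, r), cops to move: the inductive (attractor)
-- characterisation of "the cops have a strategy guaranteeing capture".
data CopWin {n p k : ℕ} .{{_ : NonZero p}} (G : TemporalGraph n p)
     : Fin p → Multiset n k → Fin n → Set where
  caught : ∀ {t C r} → r ∈ elems C → CopWin G t C r
  step   : ∀ {t C r} (C' : Multiset n k) → CopMove G t C C' →
           (r ∈ elems C' ⊎ (∀ r' → Γ G t r r' → CopWin G (next t) C' r')) →
           CopWin G t C r

-- hyperedges ((t,X),(t+1,y)) are determined by the triple (t, X, y)
Hyperedge : ℕ → ℕ → ℕ → Set
Hyperedge n p k = Fin p × Multiset n k × Fin n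

HSet : ℕ → ℕ → ℕ → Set₁
HSet n p k = Hyperedge n p k → Set

_⊆H_ : ∀ {n p k} → HSet n p k → HSet n p k → Set
A ⊆H B = ∀ h → A h → B h

kArena : ∀ {n p} → .{{NonZero p}} → TemporalGraph n p → (k : ℕ) → HSet n p k
kArena G k (t , X , y) = ∃ λ x → (x ∈ elems X) × Γ G t x y

IsAugmentedArena : ∀ {n p} → .{{NonZero p}} → TemporalGraph n p → (k : ℕ) →
                   HSet n p k → Set
IsAugmentedArena G k A =
  (kArena G k ⊆H A) × (∀ t X y → A (t , X , y) → CopWin G t X y)

AugmentedArena : ∀ {n p} → .{{NonZero p}} → TemporalGraph n p → ℕ → Set₁
AugmentedArena {n} {p} G k = Σ (HSet n p k) (IsAugmentedArena G k)

_⊑_ : ∀ {n p k} .{{_ : NonZero p}} {G : TemporalGraph n p} →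
      AugmentedArena G k → AugmentedArena G k → Set
A ⊑ B = proj₁ A ⊆H proj₁ B

IsLUB : {A : Set₁} → (A → A → Set) → {I : Set} → (I → A) → A → Set₁
IsLUB _≤_ {I} F s = (∀ i → F i ≤ s) × (∀ u → (∀ i → F i ≤ u) → s ≤ u)

IsGLB : {A : Set₁} → (A → A → Set) → {I : Set} → (I → A) → A → Set₁
IsGLB _≤_ {I} F s = (∀ i → s ≤ F i) × (∀ u → (∀ i → u ≤ F i) → u ≤ s)

IsCompleteLattice : {A : Set₁} → (A → A → Set) → Set₁
IsCompleteLattice {A} _≤_ =
  (I : Set) (F : I → A) → (∃ λ s → IsLUB _≤_ F s) × (∃ λ m → IsGLB _≤_ F m)

module Submission where

open import Defs
open import Data.Nat using (ℕ; NonZero; _≤_)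
open import Data.Product using (∃; _×_; _,_; proj₁; proj₂)
open import Data.Sum using (inj₁; inj₂)
open import Data.Fin using (Fin)
open import Data.Fin.Properties using (≤-decTotalOrder)
open import Data.List using (List; []; _∷_; length)
open import Data.List.Membership.Propositional using (_∈_)
open import Data.List.Relation.Unary.Any using (here; there)
open import Data.List.Relation.Binary.Pointwise using (Pointwise; []; _∷_; Pointwise-length)
open import Data.List.Relation.Binary.Permutation.Propositional using (_↭_; ↭-sym)
open import Data.List.Relation.Binary.Permutation.Propositional.Properties using (↭-length; ∈-resp-↭)
open import Relation.Binary.PropositionalEquality using (_≡_; refl; trans; sym)
open import Relation.Unary using (_∪_; _∩_; ⋃; ⋂)

-- The set of all k-copwin hyperedges contains every augmented arena, and is one
-- itself because a cop adjacent to y captures a robber there in a single move.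
-- Joins are unions with D^k; meets are intersections restricted to winning
-- hyperedges (for the empty family, the intersection alone would contain every
-- hyperedge).

module _ {n : ℕ} where

  open import Data.List.Sort (≤-decTotalOrder n) using (sort; sort-↭; sort-↗)

  fromList : ∀ {k} (w : List (Fin n)) → length w ≡ k → Multiset n k
  fromList w |w|≡k = mset (sort w) (trans (↭-length (sort-↭ w)) |w|≡k) (sort-↗ w)

  fromList-↭ : ∀ {k} (w : List (Fin n)) (|w|≡k : length w ≡ k) →
               w ↭ elems (fromList w |w|≡k)
  fromList-↭ w _ = ↭-sym (sort-↭ w)

module AugmentedArenas {n p : ℕ} .{{_ : NonZero p}} (G : TemporalGraph n p) (playable : Playable G) where

  edge⇒Γ : ∀ {t x y} → G t x y → Γ G t x y
  edge⇒Γ e = refl , e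

  copsCanMove : ∀ t (xs : List (Fin n)) → ∃ λ w → Pointwise (Γ G t) xs w
  copsCanMove t []       = [] , []
  copsCanMove t (x ∷ xs) with playable t x | copsCanMove t xs
  ... | v , e | w , moves = v ∷ w , edge⇒Γ e ∷ moves

  copCanReach : ∀ t {x y} (xs : List (Fin n)) → x ∈ xs → Γ G t x y →
                ∃ λ w → Pointwise (Γ G t) xs w × y ∈ w
  copCanReach t {y = y} (x ∷ xs) (here refl) x→y with copsCanMove t xs
  ... | w , moves = y ∷ w , x→y ∷ moves , here refl
  copCanReach t (x ∷ xs) (there x∈xs) x→y with playable t x | copCanReach t xs x∈xs x→y
  ... | v , e | w , moves , y∈w = v ∷ w , edge⇒Γ e ∷ moves , there y∈w

  kArena⇒CopWin : ∀ {k} t (X : Multiset n k) y → kArena G k (t , X , y) → CopWin G t X y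
  kArena⇒CopWin t X y (x , x∈X , x→y) with copCanReach t (elems X) x∈X x→y
  ... | w , moves , y∈w = step X' (w , moves , fromList-↭ w |w|≡k) (inj₁ y∈X')
    where
    |w|≡k = trans (sym (Pointwise-length moves)) (size X)
    X'    = fromList w |w|≡k
    y∈X'  = ∈-resp-↭ (fromList-↭ w |w|≡k) y∈w

  module _ (k : ℕ) where

    Winning : HSet n p k
    Winning (t , X , y) = CopWin G t X y

    winningArena : AugmentedArena G k
    winningArena = Winning , (λ { (t , X , y) → kArena⇒CopWin t X y }) , λ _ _ _ win → win

    ⊑-winningArena : (A : AugmentedArena G k) → A ⊑ winningArena
    ⊑-winningArena (_ , _ , A⇒win) (t , X , y) = A⇒win t X y

    module _ {I : Set} (F : I → AugmentedArena G k) where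

      ⨆ : AugmentedArena G k
      ⨆ = kArena G k ∪ ⋃ I (λ i → proj₁ (F i)) , (λ _ → inj₁) , ⨆⇒win
        where
        ⨆⇒win : ∀ t X y → (kArena G k ∪ ⋃ I (λ i → proj₁ (F i))) (t , X , y) → CopWin G t X y
        ⨆⇒win t X y (inj₁ h)       = kArena⇒CopWin t X y h
        ⨆⇒win t X y (inj₂ (i , h)) = proj₂ (proj₂ (F i)) t X y h

      ⨆-isLUB : IsLUB _⊑_ F ⨆
      ⨆-isLUB = (λ i h Fi-h → inj₂ (i , Fi-h)) , least
        where
        least : ∀ U → (∀ i → F i ⊑ U) → ⨆ ⊑ U
        least (_ , kArena⊆U , _) _    h (inj₁ h∈kArena) = kArena⊆U h h∈kArena
        least _                  F⊑U h (inj₂ (i , h∈Fi)) = F⊑U i h h∈Fi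

      ⨅ : AugmentedArena G k
      ⨅ = kArena G k ∪ (Winning ∩ ⋂ I (λ i → proj₁ (F i))) , (λ _ → inj₁) , ⨅⇒win
        where
        ⨅⇒win : ∀ t X y → (kArena G k ∪ (Winning ∩ ⋂ I (λ i → proj₁ (F i)))) (t , X , y) →
                CopWin G t X y
        ⨅⇒win t X y (inj₁ h)         = kArena⇒CopWin t X y h
        ⨅⇒win t X y (inj₂ (win , _)) = win

      ⨅-isGLB : IsGLB _⊑_ F ⨅
      ⨅-isGLB = lower , greatest
        where
        lower : ∀ i → ⨅ ⊑ F i
        lower i h (inj₁ h∈kArena)  = proj₁ (proj₂ (F i)) h h∈kArena
        lower i h (inj₂ (_ , h∈F)) = h∈F i

        greatest : ∀ U → (∀ i → U ⊑ F i) → U ⊑ ⨅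
        greatest U U⊑F h h∈U = inj₂ (⊑-winningArena U h h∈U , λ i → U⊑F i h h∈U)

mainTheorem8 : ∀ {n p : ℕ} .{{_ : NonZero p}} (G : TemporalGraph n p) →
    Playable G → (k : ℕ) → 1 ≤ k →
    IsCompleteLattice (_⊑_ {k = k} {G = G})
      × (∃ λ (Amax : AugmentedArena G k) → ∀ A → A ⊑ Amax)
mainTheorem8 G playable k _ =
  (λ I F → (⨆ k F , ⨆-isLUB k F) , (⨅ k F , ⨅-isGLB k F)) , (winningArena k , ⊑-winningArena k)
  where open AugmentedArenas G playable
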